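{- Let $Q\ge3$ and $r\ge2$. Suppose $a_1/q_1<a_2/q_2<\cdots<a_{r+1}/q_{r+1}$ are consecutive elements of $\mathcal F_Q$ (in lowest terms) with $a_1/q_1,\ a_{r+1}/q_{r+1}\in\mathfrak{SF}_Q$ and $a_2/q_2,\ldots,a_r/q_r\notin\mathfrak{SF}_Q$. Then $3q_1+2q_{r+1}>Q$.
   Context: $\mathcal F_Q:=\{d/b: 1\le d\le b\le Q,\ \gcd(d,b)=1\}$. For a reduced fraction $a/q\in(0,1]$ with $q\ge2$, $\bar a$ is the inverse of $a$ modulo $q$ in $[1,q)$ and $h(a/q):=q+a+\bar a$; $h(1/1):=3$; $\mathfrak{SF}_Q:=\{a/q\in\mathbb Q\cap(0,1]:h(a/q)\le Q\}$. Consecutive means adjacent in increasing order. -}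

module Defs where

open import Data.Nat using (ℕ; _+_; _*_; _≤_; _<_)
open import Data.Nat.GCD using (gcd)
open import Data.Product using (_×_; Σ)
open import Data.Sum using (_⊎_)
open import Relation.Binary.PropositionalEquality using (_≡_)
open import Relation.Nullary using (¬_)

Reduced : ℕ → ℕ → Set
Reduced a q = 1 ≤ a × a ≤ q × gcd a q ≡ 1

InF : ℕ → ℕ → ℕ → Set
InF Q a q = Reduced a q × q ≤ Q

FracLt : ℕ → ℕ → ℕ → ℕ → Set
FracLt a q b p = a * p < b * q

ConsecF : ℕ → ℕ → ℕ → ℕ → ℕ → Set
ConsecF Q a q b p =
  InF Q a q × InF Q b p × FracLt a q b p ×
  ((c d : ℕ) → InF Q c d → ¬ (FracLt a q c d × FracLt c d b p))

IsInvMod : ℕ → ℕ → ℕ → Set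
IsInvMod a q abar = 1 ≤ abar × abar < q × Σ ℕ (λ k → a * abar ≡ 1 + k * q)

-- h(a/q) ≤ Q, where h(a/q) = q + a + ā for q ≥ 2 and h(1/1) = 3
-- (ā is unique, so existence of ā with q + a + ā ≤ Q is the same as h(a/q) ≤ Q)
HLe : ℕ → ℕ → ℕ → Set
HLe Q a q =
  (a ≡ 1 × q ≡ 1 × 3 ≤ Q) ⊎
  (2 ≤ q × Σ ℕ (λ abar → IsInvMod a q abar × q + a + abar ≤ Q))

InSF : ℕ → ℕ → ℕ → Set
InSF Q a q = Reduced a q × HLe Q a q

{-# OPTIONS --safe #-}
-- Suppose 3q₁ + 2q_{r+1} ≤ Q. Stern–Brocot descent from the pair 0/1, 1/1 towards the interval
-- (a₁/q₁, a_{r+1}/q_{r+1}) stops at neighbours l₁/l₂ < r₁/r₂ (r₁l₂ − l₁r₂ = 1) whose mediant c/d lies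
-- strictly inside it; the identity X = l₂(r₁X − xr₂) + r₂(xl₂ − l₁X) forces l₂ ≤ q₁ and r₂ ≤ q_{r+1}.
-- As cl₂ − l₁d = 1, c/d is reduced with inverse l₂ modulo d, so h(c/d) = d + c + l₂ ≤ 3l₂ + 2r₂ ≤ Q.
-- Then c/d ∈ 𝓕_Q lies strictly between a₁/q₁ and a_{r+1}/q_{r+1}, so it is one of a₂/q₂, …, a_r/q_r,
-- none of which is in 𝔖𝔉_Q.
module Submission where

open import Defs
open import Data.Nat using (ℕ; zero; suc; _+_; _*_; _∸_; _≤_; _<_; _≤?_; z≤n; s≤s; >-nonZero)
open import Data.Nat.Properties
open import Data.Nat.Divisibility using (_∣_; ∣-trans; ∣-antisym; ∣m+n∣m⇒∣n; ∣1⇒≡1; m∣m*n; n∣m*n)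
open import Data.Nat.Coprimality as Coprime using (Coprime; coprime-divisor; coprime⇒gcd≡1; gcd≡1⇒coprime)
open import Data.Nat.Tactic.RingSolver using (solve-∀)
open import Algebra.Properties.CommutativeSemigroup *-commutativeSemigroup using (xy∙z≈xz∙y)
open import Data.Product using (_×_; _,_; Σ; proj₁; map₁; map₂)
open import Data.Sum using (inj₁; inj₂)
open import Data.Empty using (⊥; ⊥-elim)
open import Relation.Nullary using (¬_; yes; no)
open import Relation.Binary using (tri<; tri≈; tri>)
open import Relation.Binary.PropositionalEquality using (_≡_; refl; sym; trans; cong; cong₂; subst; subst₂; module ≡-Reasoning)

FracLe : ℕ → ℕ → ℕ → ℕ → Set
FracLe a q b p = a * p ≤ b * q

module _ {a q b p c s : ℕ} where
  open ≤-Reasoning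

  frac-≤-<-trans : 0 < q → FracLe a q b p → FracLt b p c s → FracLt a q c s
  frac-≤-<-trans 0<q a≤b b<c = *-cancelʳ-< p (a * s) (c * q) (begin-strict
    a * s * p ≡⟨ xy∙z≈xz∙y a s p ⟩
    a * p * s ≤⟨ *-monoˡ-≤ s a≤b ⟩
    b * q * s ≡⟨ xy∙z≈xz∙y b q s ⟩
    b * s * q <⟨ *-monoˡ-< q {{>-nonZero 0<q}} b<c ⟩
    c * p * q ≡⟨ xy∙z≈xz∙y c p q ⟩
    c * q * p ∎)

  frac-<-≤-trans : 0 < s → FracLt a q b p → FracLe b p c s → FracLt a q c s
  frac-<-≤-trans 0<s a<b b≤c = *-cancelʳ-< p (a * s) (c * q) (begin-strict
    a * s * p ≡⟨ xy∙z≈xz∙y a s p ⟩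
    a * p * s <⟨ *-monoˡ-< s {{>-nonZero 0<s}} a<b ⟩
    b * q * s ≡⟨ xy∙z≈xz∙y b q s ⟩
    b * s * q ≤⟨ *-monoˡ-≤ q b≤c ⟩
    c * p * q ≡⟨ xy∙z≈xz∙y c p q ⟩
    c * q * p ∎)

  frac-<-trans : 0 < s → FracLt a q b p → FracLt b p c s → FracLt a q c s
  frac-<-trans 0<s a<b b<c = frac-<-≤-trans 0<s a<b (<⇒≤ b<c)

0<denominator : ∀ {a q} → Reduced a q → 0 < q
0<denominator (1≤a , a≤q , _) = ≤-trans 1≤a a≤q

numerator>0 : ∀ {a q c d} → FracLt a q c d → 0 < c
numerator>0 {c = suc _} _ = s≤s z≤n

numerator<denominator : ∀ {c d y Y} → FracLt c d y Y → y ≤ Y → c < d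
numerator<denominator {c} {d} {y} {Y} c<y y≤Y = *-cancelʳ-< Y c d (begin-strict
  c * Y <⟨ c<y ⟩
  y * d ≤⟨ *-monoˡ-≤ d y≤Y ⟩
  Y * d ≡⟨ *-comm Y d ⟩
  d * Y ∎)
  where open ≤-Reasoning

record Unimodular (l₁ l₂ r₁ r₂ : ℕ) : Set where
  constructor mkUnimodular
  field
    det : r₁ * l₂ ≡ 1 + l₁ * r₂

module _ {l₁ l₂ r₁ r₂ : ℕ} (u : Unimodular l₁ l₂ r₁ r₂) where
  open Unimodular u

  mediant-unimodularˡ : Unimodular l₁ l₂ (l₁ + r₁) (l₂ + r₂)
  mediant-unimodularˡ = mkUnimodular (begin
    (l₁ + r₁) * l₂          ≡⟨ *-distribʳ-+ l₂ l₁ r₁ ⟩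
    l₁ * l₂ + r₁ * l₂       ≡⟨ cong (l₁ * l₂ +_) det ⟩
    l₁ * l₂ + (1 + l₁ * r₂) ≡⟨ +-suc (l₁ * l₂) (l₁ * r₂) ⟩
    1 + (l₁ * l₂ + l₁ * r₂) ≡⟨ cong suc (*-distribˡ-+ l₁ l₂ r₂) ⟨
    1 + l₁ * (l₂ + r₂)      ∎)
    where open ≡-Reasoning

  mediant-unimodularʳ : Unimodular (l₁ + r₁) (l₂ + r₂) r₁ r₂
  mediant-unimodularʳ = mkUnimodular (begin
    r₁ * (l₂ + r₂)          ≡⟨ *-distribˡ-+ r₁ l₂ r₂ ⟩
    r₁ * l₂ + r₁ * r₂       ≡⟨ cong (_+ r₁ * r₂) det ⟩
    1 + (l₁ * r₂ + r₁ * r₂) ≡⟨ cong suc (*-distribʳ-+ r₂ l₁ r₁) ⟨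
    1 + (l₁ + r₁) * r₂      ∎)
    where open ≡-Reasoning

  unimodular⇒coprimeʳ : Coprime r₁ r₂
  unimodular⇒coprimeʳ {i} (i∣r₁ , i∣r₂) = ∣1⇒≡1 (∣m+n∣m⇒∣n i∣l₁r₂+1 (∣-trans i∣r₂ (n∣m*n l₁)))
    where
    i∣l₁r₂+1 : i ∣ l₁ * r₂ + 1
    i∣l₁r₂+1 = subst (i ∣_) (trans det (+-comm 1 (l₁ * r₂))) (∣-trans i∣r₁ (m∣m*n l₂))

  unimodular-decomposition : ∀ {x X} → FracLe l₁ l₂ x X → FracLe x X r₁ r₂ →
    X ≡ l₂ * (r₁ * X ∸ x * r₂) + r₂ * (x * l₂ ∸ l₁ * X)
  unimodular-decomposition {x} {X} l≤x x≤r = +-cancelʳ-≡ K X (l₂ * s + r₂ * t) (begin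
    X + K                           ≡⟨ regroupˡ X l₁ r₂ x l₂ ⟩
    X * (1 + l₁ * r₂) + x * l₂ * r₂ ≡⟨ cong (λ e → X * e + x * l₂ * r₂) det ⟨
    X * (r₁ * l₂) + x * l₂ * r₂     ≡⟨ regroupᵐ X r₁ l₂ x r₂ ⟩
    l₂ * (r₁ * X) + r₂ * (x * l₂)   ≡⟨ cong₂ (λ e f → l₂ * e + r₂ * f) (m+[n∸m]≡n x≤r) (m+[n∸m]≡n l≤x) ⟨
    l₂ * (x * r₂ + s) + r₂ * (l₁ * X + t) ≡⟨ regroupʳ l₂ x r₂ s l₁ X t ⟩
    l₂ * s + r₂ * t + K             ∎)
    where
    open ≡-Reasoning
    s = r₁ * X ∸ x * r₂
    t = x * l₂ ∸ l₁ * X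
    K = l₁ * X * r₂ + x * l₂ * r₂
    regroupˡ : ∀ X l₁ r₂ x l₂ → X + (l₁ * X * r₂ + x * l₂ * r₂) ≡ X * (1 + l₁ * r₂) + x * l₂ * r₂
    regroupˡ = solve-∀
    regroupᵐ : ∀ X r₁ l₂ x r₂ → X * (r₁ * l₂) + x * l₂ * r₂ ≡ l₂ * (r₁ * X) + r₂ * (x * l₂)
    regroupᵐ = solve-∀
    regroupʳ : ∀ l₂ x r₂ s l₁ X t →
      l₂ * (x * r₂ + s) + r₂ * (l₁ * X + t) ≡ l₂ * s + r₂ * t + (l₁ * X * r₂ + x * l₂ * r₂)
    regroupʳ = solve-∀

  denominatorˡ≤ : ∀ {x X} → FracLe l₁ l₂ x X → FracLt x X r₁ r₂ → l₂ ≤ X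
  denominatorˡ≤ {x} {X} l≤x x<r = begin
    l₂                 ≤⟨ m≤m*n l₂ s {{>-nonZero (m<n⇒0<n∸m x<r)}} ⟩
    l₂ * s             ≤⟨ m≤m+n (l₂ * s) (r₂ * t) ⟩
    l₂ * s + r₂ * t    ≡⟨ unimodular-decomposition {x} {X} l≤x (<⇒≤ x<r) ⟨
    X                  ∎
    where
    open ≤-Reasoning
    s = r₁ * X ∸ x * r₂
    t = x * l₂ ∸ l₁ * X

  denominatorʳ≤ : ∀ {x X} → FracLt l₁ l₂ x X → FracLe x X r₁ r₂ → r₂ ≤ X
  denominatorʳ≤ {x} {X} l<x x≤r = begin
    r₂                 ≤⟨ m≤m*n r₂ t {{>-nonZero (m<n⇒0<n∸m l<x)}} ⟩
    r₂ * t             ≤⟨ m≤n+m (r₂ * t) (l₂ * s) ⟩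
    l₂ * s + r₂ * t    ≡⟨ unimodular-decomposition {x} {X} (<⇒≤ l<x) x≤r ⟨
    X                  ∎
    where
    open ≤-Reasoning
    s = r₁ * X ∸ x * r₂
    t = x * l₂ ∸ l₁ * X

record Bracket (x X y Y : ℕ) : Set where
  constructor bracket
  field
    l₁ l₂ r₁ r₂ : ℕ
    0<l₂ : 0 < l₂
    0<r₂ : 0 < r₂
    unimodular : Unimodular l₁ l₂ r₁ r₂
    l≤x : FracLe l₁ l₂ x X
    y≤r : FracLe y Y r₁ r₂

  m₁ m₂ : ℕ
  m₁ = l₁ + r₁
  m₂ = l₂ + r₂

  l₂≤X : FracLt x X y Y → l₂ ≤ X
  l₂≤X x<y = denominatorˡ≤ unimodular {x} {X} l≤x (frac-<-≤-trans {x} {X} {y} {Y} {r₁} {r₂} 0<r₂ x<y y≤r)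

  r₂≤Y : FracLt x X y Y → r₂ ≤ Y
  r₂≤Y x<y = denominatorʳ≤ unimodular {y} {Y} (frac-≤-<-trans {l₁} {l₂} {x} {X} {y} {Y} 0<l₂ l≤x x<y) y≤r

  MediantInside : Set
  MediantInside = FracLt x X m₁ m₂ × FracLt m₁ m₂ y Y

  m₂≤X+Y : FracLt x X y Y → m₂ ≤ X + Y
  m₂≤X+Y x<y = +-mono-≤ (l₂≤X x<y) (r₂≤Y x<y)

unit-bracket : ∀ {x X y Y} → y ≤ Y → Bracket x X y Y
unit-bracket {y = y} {Y} y≤Y =
  bracket 0 1 1 1 (s≤s z≤n) (s≤s z≤n) (mkUnimodular refl) z≤n
    (subst₂ _≤_ (sym (*-identityʳ y)) (sym (*-identityˡ Y)) y≤Y)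

module _ {x X y Y : ℕ} (b : Bracket x X y Y) where
  open Bracket b

  narrowˡ : FracLe m₁ m₂ x X → Bracket x X y Y
  narrowˡ m≤x = bracket m₁ m₂ r₁ r₂ (<-≤-trans 0<l₂ (m≤m+n l₂ r₂)) 0<r₂ (mediant-unimodularʳ unimodular) m≤x y≤r

  narrowʳ : FracLe y Y m₁ m₂ → Bracket x X y Y
  narrowʳ y≤m = bracket l₁ l₂ m₁ m₂ 0<l₂ (<-≤-trans 0<l₂ (m≤m+n l₂ r₂)) (mediant-unimodularˡ unimodular) l≤x y≤m

m<n⇒m+suc[o]≤n+o : ∀ {m n} o → m < n → m + suc o ≤ n + o
m<n⇒m+suc[o]≤n+o {m} o m<n = ≤-trans (≤-reflexive (+-suc m o)) (+-monoˡ-≤ o m<n)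

-- Stern–Brocot descent: each narrowing strictly increases m₂, which stays ≤ X + Y.
find-mediant : ∀ {x X y Y} → FracLt x X y Y → ∀ fuel (b : Bracket x X y Y) →
  X + Y < Bracket.m₂ b + fuel → Σ (Bracket x X y Y) Bracket.MediantInside
find-mediant {X = X} {Y = Y} x<y zero b exhausted =
  ⊥-elim (<⇒≱ exhausted (subst (_≤ X + Y) (sym (+-identityʳ _)) (Bracket.m₂≤X+Y b x<y)))
find-mediant {x} {X} {y} {Y} x<y (suc fuel) b bound
  with Bracket.m₁ b * X ≤? x * Bracket.m₂ b | y * Bracket.m₂ b ≤? Bracket.m₁ b * Y
... | yes m≤x | _ = find-mediant x<y fuel (narrowˡ b m≤x)
  (≤-trans bound (m<n⇒m+suc[o]≤n+o fuel (m<m+n (Bracket.m₂ b) (Bracket.0<r₂ b))))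
... | no m≰x | yes y≤m = find-mediant x<y fuel (narrowʳ b y≤m)
  (≤-trans bound (m<n⇒m+suc[o]≤n+o fuel (m<n+m (Bracket.m₂ b) (Bracket.0<l₂ b))))
... | no m≰x | no y≰m = b , ≰⇒> m≰x , ≰⇒> y≰m

mediant-between : ∀ {x X y Y} → FracLt x X y Y → y ≤ Y → Σ (Bracket x X y Y) Bracket.MediantInside
mediant-between {X = X} {Y = Y} x<y y≤Y = find-mediant x<y (X + Y) (unit-bracket y≤Y) (n≤1+n _)

InSF⇒InF : ∀ {Q a q} → InSF Q a q → InF Q a q
InSF⇒InF (red , inj₁ (_ , refl , 3≤Q)) = red , ≤-trans (s≤s z≤n) 3≤Q
InSF⇒InF {a = a} {q} (red , inj₂ (_ , ā , _ , h≤Q)) =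
  red , ≤-trans (≤-trans (m≤m+n q a) (m≤m+n (q + a) ā)) h≤Q

mediant-in-𝔖𝔉 : ∀ {Q x X y Y} → FracLt x X y Y → y ≤ Y → 3 * X + 2 * Y ≤ Q →
  Σ ℕ λ c → Σ ℕ λ d → InSF Q c d × FracLt x X c d × FracLt c d y Y
mediant-in-𝔖𝔉 {Q} {x} {X} {y} {Y} x<y y≤Y bound with mediant-between {x} x<y y≤Y
... | b , x<m , m<y =
  m₁ , m₂ , (reduced , inj₂ (2≤m₂ , l₂ , (0<l₂ , m<m+n l₂ 0<r₂ , l₁ , inverse) , height≤Q)) , x<m , m<y
  where
  open Bracket b
  inverse : m₁ * l₂ ≡ 1 + l₁ * m₂
  inverse = Unimodular.det (mediant-unimodularˡ unimodular)
  m₁<m₂ : m₁ < m₂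
  m₁<m₂ = numerator<denominator {m₁} {m₂} {y} {Y} m<y y≤Y
  reduced : Reduced m₁ m₂
  reduced = numerator>0 {x} {X} x<m , <⇒≤ m₁<m₂ , coprime⇒gcd≡1 (unimodular⇒coprimeʳ (mediant-unimodularˡ unimodular))
  2≤m₂ : 2 ≤ m₂
  2≤m₂ = +-mono-≤ 0<l₂ 0<r₂
  height≤Q : m₂ + m₁ + l₂ ≤ Q
  height≤Q = begin
    m₂ + m₁ + l₂            ≤⟨ +-monoˡ-≤ l₂ (+-monoʳ-≤ m₂ (<⇒≤ m₁<m₂)) ⟩
    m₂ + m₂ + l₂            ≡⟨ regroup l₂ r₂ ⟩
    3 * l₂ + 2 * r₂         ≤⟨ +-mono-≤ (*-monoʳ-≤ 3 (l₂≤X x<y)) (*-monoʳ-≤ 2 (r₂≤Y x<y)) ⟩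
    3 * X + 2 * Y           ≤⟨ bound ⟩
    Q                       ∎
    where
    open ≤-Reasoning
    regroup : ∀ l r → l + r + (l + r) + l ≡ 3 * l + 2 * r
    regroup = solve-∀

reduced-cross-≡ : ∀ {a q b p} → Reduced a q → Reduced b p → a * p ≡ b * q → a ≡ b × q ≡ p
reduced-cross-≡ {a} {q} {b} {p} (_ , _ , gcd[a,q]≡1) b/p@(_ , _ , gcd[b,p]≡1) ap≡bq = a≡b , q≡p
  where
  q∣p : q ∣ p
  q∣p = coprime-divisor (Coprime.sym (gcd≡1⇒coprime {a} gcd[a,q]≡1)) (subst (q ∣_) (sym ap≡bq) (n∣m*n b))
  p∣q : p ∣ q
  p∣q = coprime-divisor (Coprime.sym (gcd≡1⇒coprime {b} gcd[b,p]≡1)) (subst (p ∣_) ap≡bq (n∣m*n a))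
  q≡p : q ≡ p
  q≡p = ∣-antisym q∣p p∣q
  a≡b : a ≡ b
  a≡b = *-cancelʳ-≡ a b p {{>-nonZero (0<denominator {b} b/p)}} (subst (λ t → a * p ≡ b * t) q≡p ap≡bq)

nothing-between : ∀ {Q a q b p c d} → ConsecF Q a q b p → InF Q c d → FracLt a q c d → FracLt c d b p → ⊥
nothing-between (_ , _ , _ , empty) z∈F a<z z<b = empty _ _ z∈F (a<z , z<b)

ConsecutiveRun : ℕ → ℕ → (ℕ → ℕ) → (ℕ → ℕ) → Set
ConsecutiveRun Q r a q = (i : ℕ) → 1 ≤ i → i ≤ r → ConsecF Q (a i) (q i) (a (suc i)) (q (suc i))

module _ {Q : ℕ} {a q : ℕ → ℕ} where

  run-shorten : ∀ {r} → ConsecutiveRun Q (suc r) a q → ConsecutiveRun Q r a q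
  run-shorten run i 1≤i i≤r = run i 1≤i (m≤n⇒m≤1+n i≤r)

  run-increasing : ∀ r → 1 ≤ r → ConsecutiveRun Q r a q → FracLt (a 1) (q 1) (a (suc r)) (q (suc r))
  run-increasing (suc zero) _ run =
    let (_ , _ , a₁<a₂ , _) = run 1 ≤-refl ≤-refl in a₁<a₂
  run-increasing (suc (suc r)) _ run =
    let (_ , (aₙ/qₙ , _) , aᵣ<aₙ , _) = run (suc (suc r)) (s≤s z≤n) ≤-refl
    in frac-<-trans {a 1} {q 1} {a (2 + r)} {q (2 + r)} {a (3 + r)}
         (0<denominator aₙ/qₙ) (run-increasing (suc r) (s≤s z≤n) (run-shorten run)) aᵣ<aₙ

  later-than-first⇒1≤r : ∀ {c d} r → FracLt (a 1) (q 1) c d → c * q (suc r) ≡ a (suc r) * d → 1 ≤ r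
  later-than-first⇒1≤r zero    a₁<z z≈a₁ = ⊥-elim (<-irrefl (sym z≈a₁) a₁<z)
  later-than-first⇒1≤r (suc r) _    _    = s≤s z≤n

  run-covers : ∀ {c d} r → ConsecutiveRun Q r a q → InF Q c d →
    FracLt (a 1) (q 1) c d → FracLt c d (a (suc r)) (q (suc r)) →
    Σ ℕ λ j → 2 ≤ j × j ≤ r × c * q j ≡ a j * d
  run-covers zero _ _ a₁<z z<a₁ = ⊥-elim (<-asym a₁<z z<a₁)
  run-covers {c} {d} (suc r) run z∈F a₁<z z<aₙ with <-cmp (c * q (suc r)) (a (suc r) * d)
  ... | tri< z<aᵣ _ _ = map₂ (map₂ (map₁ m≤n⇒m≤1+n)) (run-covers r (run-shorten run) z∈F a₁<z z<aᵣ)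
  ... | tri≈ _ z≈aᵣ _ = suc r , s≤s (later-than-first⇒1≤r {c} r a₁<z z≈aᵣ) , ≤-refl , z≈aᵣ
  ... | tri> _ _ aᵣ<z = ⊥-elim (nothing-between (run (suc r) (s≤s z≤n) ≤-refl) z∈F aᵣ<z z<aₙ)

lemma7 : (Q r : ℕ) → 3 ≤ Q → 2 ≤ r → (a q : ℕ → ℕ) →
    ((i : ℕ) → 1 ≤ i → i ≤ r → ConsecF Q (a i) (q i) (a (suc i)) (q (suc i))) →
    InSF Q (a 1) (q 1) → InSF Q (a (suc r)) (q (suc r)) →
    ((i : ℕ) → 2 ≤ i → i ≤ r → ¬ InSF Q (a i) (q i)) →
    Q < 3 * q 1 + 2 * q (suc r)
lemma7 Q r _ 2≤r a q run _ ((_ , aₙ≤qₙ , _) , _) notSF with 3 * q 1 + 2 * q (suc r) ≤? Q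
... | no  bound≰Q = ≰⇒> bound≰Q
... | yes bound≤Q =
  let a₁<aₙ = run-increasing r (<⇒≤ 2≤r) run
      (c , d , z∈𝔖𝔉 , a₁<z , z<aₙ) = mediant-in-𝔖𝔉 {x = a 1} a₁<aₙ aₙ≤qₙ bound≤Q
      (j , 2≤j , j≤r , z≈aⱼ) = run-covers r run (InSF⇒InF z∈𝔖𝔉) a₁<z z<aₙ
      ((aⱼ/qⱼ , _) , _) = run j (<⇒≤ 2≤j) j≤r
      (c≡aⱼ , d≡qⱼ) = reduced-cross-≡ (proj₁ z∈𝔖𝔉) aⱼ/qⱼ z≈aⱼ
  in ⊥-elim (notSF j 2≤j j≤r (subst₂ (InSF Q) c≡aⱼ d≡qⱼ z∈𝔖𝔉))
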